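{- Let $\langle S,\phi\rangle$ be a reduced closure system. For $X,Y\subseteq S$ write $X\ll Y$ if for every $x\in X$ there is $y\in Y$ with $x\in\phi(\{y\})$, and write $X\sim_\ll Y$ if $X\ll Y$ and $Y\ll X$. Then every $\sim_\ll$-equivalence class $[X]=\{Y\subseteq S: Y\sim_\ll X\}$ has a unique minimal element with respect to set containment.
   Context: A closure system is a pair $\langle S,\phi\rangle$ where $S$ is a finite nonempty set and $\phi:2^S\to 2^S$ is a closure operator, i.e. $X\subseteq\phi(X)$, $X\subseteq Y\Rightarrow \phi(X)\subseteq\phi(Y)$, and $\phi(\phi(X))=\phi(X)$ for all $X,Y\subseteq S$. It is called reduced if $\phi(\{i\})=\phi(\{j\})$ implies $i=j$ for all $i,j\in S$. The relation $\ll$ is a quasi-order on $2^S$, so $\sim_\ll$ is an equivalence relation. -}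

module Defs where

open import Data.Nat using (ℕ)
open import Data.Fin using (Fin)
open import Data.Fin.Subset using (Subset; _⊆_; _∈_; ⁅_⁆)
open import Data.Product using (_×_; ∃-syntax)
open import Relation.Binary.PropositionalEquality using (_≡_)

record IsClosure {n : ℕ} (φ : Subset n → Subset n) : Set where
  field
    extensive  : ∀ X → X ⊆ φ X
    monotone   : ∀ {X Y} → X ⊆ Y → φ X ⊆ φ Y
    idempotent : ∀ X → φ (φ X) ≡ φ X

Reduced : {n : ℕ} → (Subset n → Subset n) → Set
Reduced {n} φ = ∀ (i j : Fin n) → φ ⁅ i ⁆ ≡ φ ⁅ j ⁆ → i ≡ j

_≪[_]_ : {n : ℕ} → Subset n → (Subset n → Subset n) → Subset n → Set
_≪[_]_ {n} X φ Y = ∀ (x : Fin n) → x ∈ X → ∃[ y ] (y ∈ Y × x ∈ φ ⁅ y ⁆)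

_∼≪[_]_ : {n : ℕ} → Subset n → (Subset n → Subset n) → Subset n → Set
X ∼≪[ φ ] Y = (X ≪[ φ ] Y) × (Y ≪[ φ ] X)

MinimalInClass : {n : ℕ} → (Subset n → Subset n) → Subset n → Subset n → Set
MinimalInClass φ X M = (M ∼≪[ φ ] X) × (∀ Y → Y ∼≪[ φ ] X → Y ⊆ M → Y ≡ M)

-- Order the points by x ⊑ y ⇔ x ∈ φ{y}; this is a preorder for any closure operator and
-- a partial order exactly when the system is reduced. The class of X then has a least
-- element: the ⊑-maximal elements of X. They dominate X because the order is finite, and
-- every Y ∼≪ X contains them, since a maximal a lies below some y ∈ Y, which lies below
-- some x ∈ X, and maximality forces x = a, hence y = a. A least element of the class is
-- its unique minimal element.
module Submission where

open import Defs
open import Level using (Level)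
open import Data.Nat using (ℕ; suc)
open import Data.Bool using (true)
open import Data.Fin using (Fin)
open import Data.Fin.Properties using (_≟_; all?; any?)
open import Data.Fin.Subset using (Subset; _⊆_; _∈_; _⊃_; ⁅_⁆)
open import Data.Fin.Subset.Properties using (x∈⁅x⁆; x∈⁅y⁆⇒x≡y; ⊆-antisym; _∈?_)
open import Data.Fin.Subset.Induction using (⊃-wellFounded)
open import Data.Vec using (tabulate)
open import Data.Vec.Properties using (lookup∘tabulate; []=⇒lookup; lookup⇒[]=)
open import Data.Product using (_×_; ∃-syntax; _,_; proj₁)
open import Function using (_∘_)
open import Induction.WellFounded using (Acc; acc)
open import Relation.Binary.PropositionalEquality using (_≡_; sym; trans; subst)
open import Relation.Nullary using (Dec; ¬_; yes; no; does; proof; ¬?; _×-dec_; _→-dec_; contradiction)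
open import Relation.Nullary.Decidable using (dec-true)
open import Relation.Nullary.Reflects using (Reflects; invert)
open import Relation.Unary using (Pred; Decidable)

module _ {ℓ : Level} {m : ℕ} {P : Pred (Fin m) ℓ} (P? : Decidable P) where

  toSubset : Subset m
  toSubset = tabulate (does ∘ P?)

  ∈-toSubset⁺ : ∀ {x} → P x → x ∈ toSubset
  ∈-toSubset⁺ {x} px = lookup⇒[]= x toSubset
    (trans (lookup∘tabulate (does ∘ P?) x) (dec-true (P? x) px))

  ∈-toSubset⁻ : ∀ {x} → x ∈ toSubset → P x
  ∈-toSubset⁻ {x} x∈ = invert (subst (Reflects (P x)) does≡true (proof (P? x)))
    where
    does≡true : does (P? x) ≡ true
    does≡true = trans (sym (lookup∘tabulate (does ∘ P?) x)) ([]=⇒lookup x∈)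

module _ {m : ℕ} {φ : Subset m → Subset m} (closure : IsClosure φ) where
  open IsClosure closure

  infix 4 _⊑_ _⊑?_

  _⊑_ : Fin m → Fin m → Set
  x ⊑ y = x ∈ φ ⁅ y ⁆

  _⊑?_ : ∀ x y → Dec (x ⊑ y)
  x ⊑? y = x ∈? φ ⁅ y ⁆

  ⊑-refl : ∀ x → x ⊑ x
  ⊑-refl x = extensive ⁅ x ⁆ (x∈⁅x⁆ x)

  ⊑⇒φ⁅⁆⊆ : ∀ {x y} → x ⊑ y → φ ⁅ x ⁆ ⊆ φ ⁅ y ⁆
  ⊑⇒φ⁅⁆⊆ {x} {y} x⊑y z∈ = subst (_ ∈_) (idempotent ⁅ y ⁆)
    (monotone (λ w∈ → subst (_⊑ y) (sym (x∈⁅y⁆⇒x≡y _ w∈)) x⊑y) z∈)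

  ⊑-trans : ∀ {x y z} → x ⊑ y → y ⊑ z → x ⊑ z
  ⊑-trans x⊑y y⊑z = ⊑⇒φ⁅⁆⊆ y⊑z x⊑y

  ⊑-antisym : Reduced φ → ∀ {x y} → x ⊑ y → y ⊑ x → x ≡ y
  ⊑-antisym reduced x⊑y y⊑x = reduced _ _ (⊆-antisym (⊑⇒φ⁅⁆⊆ x⊑y) (⊑⇒φ⁅⁆⊆ y⊑x))

  IsMaximalIn : Subset m → Fin m → Set
  IsMaximalIn X a = a ∈ X × (∀ x → x ∈ X → a ⊑ x → x ≡ a)

  isMaximalIn? : ∀ X → Decidable (IsMaximalIn X)
  isMaximalIn? X a = (a ∈? X) ×-dec all? (λ x → (x ∈? X) →-dec (a ⊑? x) →-dec (x ≟ a))

  maximals : Subset m → Subset m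
  maximals X = toSubset (isMaximalIn? X)

  module _ (reduced : Reduced φ) {X : Subset m} where

    below-maximal : ∀ {x} → x ∈ X → ∃[ a ] (a ∈ maximals X × x ⊑ a)
    below-maximal {x} x∈X = go x∈X (⊃-wellFounded (φ ⁅ x ⁆))
      where
      -- A strict ⊑-step from x to y strictly enlarges φ{x} to φ{y}.
      go : ∀ {x} → x ∈ X → Acc _⊃_ (φ ⁅ x ⁆) → ∃[ a ] (a ∈ maximals X × x ⊑ a)
      go {x} x∈X (acc rec)
        with any? (λ y → (y ∈? X) ×-dec (x ⊑? y) ×-dec ¬? (y ≟ x))
      ... | yes (y , y∈X , x⊑y , y≢x) =
        let a , a∈ , y⊑a = go y∈X (rec (⊑⇒φ⁅⁆⊆ x⊑y , y , ⊑-refl y , y⋢x))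
        in a , a∈ , ⊑-trans x⊑y y⊑a
        where
        y⋢x : ¬ y ⊑ x
        y⋢x y⊑x = y≢x (⊑-antisym reduced y⊑x x⊑y)
      ... | no ∄y = x , ∈-toSubset⁺ (isMaximalIn? X) (x∈X , x-maximal) , ⊑-refl x
        where
        x-maximal : ∀ z → z ∈ X → x ⊑ z → z ≡ x
        x-maximal z z∈X x⊑z with z ≟ x
        ... | yes z≡x = z≡x
        ... | no z≢x = contradiction (z , z∈X , x⊑z , z≢x) ∄y

    maximals-∼≪ : maximals X ∼≪[ φ ] X
    maximals-∼≪ =
      (λ a a∈ → a , proj₁ (∈-toSubset⁻ (isMaximalIn? X) a∈) , ⊑-refl a) ,
      (λ x x∈X → below-maximal x∈X)

    maximals-⊆ : ∀ {Y} → Y ∼≪[ φ ] X → maximals X ⊆ Y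
    maximals-⊆ {Y} (Y≪X , X≪Y) {a} a∈
      with a∈X , a-maximal ← ∈-toSubset⁻ (isMaximalIn? X) a∈
      with y , y∈Y , a⊑y ← X≪Y a a∈X
      with x , x∈X , y⊑x ← Y≪X y y∈Y =
      let x≡a = a-maximal x x∈X (⊑-trans a⊑y y⊑x)
      in subst (_∈ Y) (⊑-antisym reduced (subst (y ⊑_) x≡a y⊑x) a⊑y) y∈Y

least⇒unique-minimal : ∀ {m} {φ : Subset m → Subset m} {X M} →
                       M ∼≪[ φ ] X → (∀ Y → Y ∼≪[ φ ] X → M ⊆ Y) →
                       MinimalInClass φ X M × (∀ M′ → MinimalInClass φ X M′ → M′ ≡ M)
least⇒unique-minimal {M = M} M∼X M-least =
  (M∼X , λ Y Y∼X Y⊆M → ⊆-antisym Y⊆M (M-least Y Y∼X)) ,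
  λ M′ (M′∼X , M′-minimal) → sym (M′-minimal M M∼X (M-least M′ M′∼X))

lemma5 : (n : ℕ) (φ : Subset (suc n) → Subset (suc n)) → IsClosure φ → Reduced φ →
         ∀ (X : Subset (suc n)) →
           ∃[ M ] (MinimalInClass φ X M × (∀ M′ → MinimalInClass φ X M′ → M′ ≡ M))
lemma5 n φ closure reduced X =
  maximals closure X ,
  least⇒unique-minimal {φ = φ} (maximals-∼≪ closure reduced)
                                 (λ Y Y∼X → maximals-⊆ closure reduced Y∼X)
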